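{- Let $P$ be a CR-Prolog program with some answer set $X$ and a corresponding abductive support $R$ (i.e. $X$ is an answer set of $P^{reg}\cup\alpha(R)$). Then $X$ is also an answer set of the A-Prolog program $P'=P^{reg}\cup f(\alpha(R))$, where $f(\alpha(R))$ is the set of facts obtained by dropping the bodies of the rules in $\alpha(R)$.
   Context: A literal is an atom $a$ or its classical negation $\neg a$; a context is a consistent set of literals (all contexts considered are consistent). A regular rule $r$ has the form $l_1 \vee \dots \vee l_k \leftarrow l_{k+1},\dots,l_m, \mathrm{not}\ l_{m+1},\dots,\mathrm{not}\ l_n$ with $1\le k\le m\le n$; its head is $\{l_1,\dots,l_k\}$ and its body the extended literals after $\leftarrow$. For a regular rule $r$, $f(r)$ is the rule obtained from $r$ by dropping its body (a fact), and $f(S)=\{f(r):r\in S\}$. A context $X$ satisfies $r$ if, whenever $l_{k+1},\dots,l_m\in X$ and $l_{m+1},\dots,l_n\notin X$, some head literal is in $X$. An A-Prolog program is a finite set of regular rules. For a program without default negation, $X$ is an answer set if $X$ satisfies it and no proper subset does; in general, the reduct $P^X$ removes every rule containing $\mathrm{not}\ l$ with $l\in X$ and deletes the remaining $\mathrm{not}$-literals, and $X$ is an answer set of $P$ if it is an answer set of $P^X$; $P$ is consistent if it has an answer set. A cr-rule has the form $l_0 \stackrel{+}{\leftarrow} l_1,\dots,l_m,\mathrm{not}\ l_{m+1},\dots,\mathrm{not}\ l_n$. A CR-Prolog program $P$ is a finite set of regular rules and cr-rules, $P^{reg}$ its regular rules, $P^{cr}$ its cr-rules. $\alpha(r)$ is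 the regular rule obtained from a cr-rule $r$ by replacing $\stackrel{+}{\leftarrow}$ by $\leftarrow$; $\alpha(R)=\{\alpha(r):r\in R\}$. $R\subseteq P^{cr}$ is an abductive support of $P$ if $P^{reg}\cup\alpha(R)$ is consistent and no $R'\subseteq P^{cr}$ with $|R'|<|R|$ makes $P^{reg}\cup\alpha(R')$ consistent. $X$ is an answer set of $P$ if it is an answer set of $P^{reg}\cup\alpha(R)$ for some abductive support $R$ (called a corresponding abductive support). -}

module Defs where

open import Data.Nat using (ℕ; _<_)
import Data.Nat as ℕ
open import Data.List using (List; []; _∷_; _++_; map; filter; length)
open import Data.List.Membership.Propositional using (_∈_; _∉_)
open import Data.List.Membership.DecPropositional using () renaming (_∈?_ to mem?)
open import Data.List.Relation.Unary.Any using (any?)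
open import Data.List.Relation.Unary.Unique.Propositional using (Unique)
open import Data.Product using (Σ; ∃; _×_; _,_)
open import Relation.Nullary using (¬_; yes; no; ¬?)
open import Relation.Binary.PropositionalEquality using (_≡_; refl; cong)
open import Relation.Binary.Definitions using (DecidableEquality)

Atom : Set
Atom = ℕ

-- A literal: an atom a or its classical negation ¬a.
data Literal : Set where
  pos : Atom → Literal
  neg : Atom → Literal

_≟L_ : DecidableEquality Literal
pos a ≟L pos b with a ℕ.≟ b
... | yes refl = yes refl
... | no a≢b = no λ { refl → a≢b refl }
pos a ≟L neg b = no λ ()
neg a ≟L pos b = no λ ()
neg a ≟L neg b with a ℕ.≟ b
... | yes refl = yes refl
... | no a≢b = no λ { refl → a≢b refl }

-- Finite sets of literals, represented by lists (order/duplicates irrelevant).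
LitSet : Set
LitSet = List Literal

_⊆_ : LitSet → LitSet → Set
Y ⊆ X = ∀ {l} → l ∈ Y → l ∈ X

_⊂_ : LitSet → LitSet → Set
Y ⊂ X = Y ⊆ X × ¬ (X ⊆ Y)

Consistent : LitSet → Set
Consistent X = ∀ a → ¬ (pos a ∈ X × neg a ∈ X)

-- Regular rule  l₁ ∨ … ∨ lₖ ← l_{k+1},…,l_m, not l_{m+1},…, not l_n   with k ≥ 1.
-- The head is  hd ∷ hdRest  (so it is nonempty).
record Rule : Set where
  constructor rule
  field
    hd     : Literal
    hdRest : List Literal
    body⁺  : List Literal
    body⁻  : List Literal   -- literals occurring under "not"

open Rule public

head : Rule → List Literal
head r = hd r ∷ hdRest r

Satisfies : LitSet → Rule → Set
Satisfies X r =
  (∀ {l} → l ∈ body⁺ r → l ∈ X) →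
  (∀ {l} → l ∈ body⁻ r → l ∉ X) →
  ∃ λ l → l ∈ head r × l ∈ X

Program : Set
Program = List Rule

SatisfiesProg : LitSet → Program → Set
SatisfiesProg X P = ∀ {r} → r ∈ P → Satisfies X r

-- Answer set of a program (intended to be without default negation):
-- X is a context satisfying P and no proper subset (context) satisfies P.
AnswerSetPos : Program → LitSet → Set
AnswerSetPos P X =
  Consistent X × SatisfiesProg X P ×
  (∀ Y → Y ⊂ X → Consistent Y → ¬ SatisfiesProg Y P)

dropNeg : Rule → Rule
dropNeg (rule h hs b⁺ b⁻) = rule h hs b⁺ []

reduct : Program → LitSet → Program
reduct P X =
  map dropNeg (filter (λ r → ¬? (any? (λ l → mem? _≟L_ l X) (body⁻ r))) P)

AnswerSet : Program → LitSet → Set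
AnswerSet P X = AnswerSetPos (reduct P X) X

ConsistentProg : Program → Set
ConsistentProg P = ∃ λ X → AnswerSet P X

-- cr-rule  l₀ +← l₁,…,l_m, not l_{m+1},…, not l_n
record CRRule : Set where
  constructor crrule
  field
    crHead  : Literal
    crBody⁺ : List Literal
    crBody⁻ : List Literal

open CRRule public

record CRProgram : Set where
  constructor crprog
  field
    reg : List Rule
    cr  : List CRRule

open CRProgram public

α : CRRule → Rule
α r = rule (crHead r) [] (crBody⁺ r) (crBody⁻ r)

αs : List CRRule → Program
αs R = map α R

f : Rule → Rule
f (rule h hs b⁺ b⁻) = rule h hs [] []

fs : Program → Program
fs S = map f S

-- Subsets R ⊆ P^cr are represented by duplicate-free lists of cr-rules of P;
-- |R| is then the length of the list.
CRSubset : CRProgram → List CRRule → Set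
CRSubset P R = Unique R × (∀ {r} → r ∈ R → r ∈ cr P)

AbductiveSupport : CRProgram → List CRRule → Set
AbductiveSupport P R =
  CRSubset P R ×
  ConsistentProg (reg P ++ αs R) ×
  (∀ R' → CRSubset P R' → length R' < length R →
     ¬ ConsistentProg (reg P ++ αs R'))

AnswerSetWithSupport : CRProgram → LitSet → List CRRule → Set
AnswerSetWithSupport P X R =
  AbductiveSupport P R × AnswerSet (reg P ++ αs R) X

module Submission where

-- Answer sets are tested against the reduct P^X, so we first
-- describe "Y is a model of P^X" directly in terms of P (ReductModel): every
-- rule of P not blocked by X whose positive body holds in Y has a head literal
-- in Y.  In this form one general transfer principle does all the work: X stays
-- an answer set when P is replaced by Q, provided X is a model of Q^X and every
-- Y ⊆ X modelling Q^X also models P^X.  Two instances follow: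
--   * rules whose heads are false in X may be dropped from a program;
--   * rules whose heads are true in X may be replaced by their heads as facts.
-- The first instance, with the minimality of an abductive support R, shows that
-- every cr-rule of R has its head in X (otherwise R minus that rule would be a
-- smaller support).  The second instance then yields the theorem: X is an
-- answer set of  P^reg ∪ f(α(R)).

open import Defs
open import Data.List using (List; _++_; filter; length)
open import Data.Nat using (_<_)
open import Data.List.Membership.Propositional using (_∈_; _∉_)
open import Data.List.Membership.Propositional.Properties
  using (∈-map⁺; ∈-map⁻; ∈-filter⁺; ∈-filter⁻; ∈-++⁺ˡ; ∈-++⁺ʳ; ∈-++⁻)
open import Data.List.Membership.DecPropositional using () renaming (_∈?_ to mem?)
open import Data.List.Relation.Unary.Any using (Any; here; any?)
import Data.List.Relation.Unary.Any as Any
import Data.List.Relation.Unary.Unique.Propositional.Properties as Unique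
open import Data.List.Properties using (≡-dec; filter-notAll)
open import Data.Product using (∃; _×_; _,_; proj₁; proj₂)
open import Data.Sum using (_⊎_; inj₁; inj₂)
open import Data.Empty using (⊥-elim)
open import Relation.Nullary using (¬_; yes; no; ¬?; Dec)
open import Relation.Binary.PropositionalEquality using (_≡_; refl)
open import Relation.Binary.Definitions using (DecidableEquality)

Blocked : LitSet → Rule → Set
Blocked X r = Any (_∈ X) (body⁻ r)

-- The decision procedure used by `reduct`, so that filter membership lemmas apply.
blocked? : (X : LitSet) (r : Rule) → Dec (Blocked X r)
blocked? X r = any? (λ l → mem? _≟L_ l X) (body⁻ r)

HeadMeets : LitSet → Rule → Set
HeadMeets Y r = ∃ λ l → l ∈ head r × l ∈ Y

ReductModel : LitSet → LitSet → Program → Set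
ReductModel Y X P =
  ∀ {r} → r ∈ P → ¬ Blocked X r → (∀ {l} → l ∈ body⁺ r → l ∈ Y) → HeadMeets Y r

reductModel⇒satisfies : ∀ {Y X} P → ReductModel Y X P → SatisfiesProg Y (reduct P X)
reductModel⇒satisfies {X = X} P model r∈ body⁺⊆Y _ with ∈-map⁻ dropNeg r∈
... | r , r∈filter , refl with ∈-filter⁻ (λ r → ¬? (blocked? X r)) {xs = P} r∈filter
... | r∈P , unblocked = model r∈P unblocked body⁺⊆Y

satisfies⇒reductModel : ∀ {Y X} P → SatisfiesProg Y (reduct P X) → ReductModel Y X P
satisfies⇒reductModel {X = X} P sat r∈P unblocked body⁺⊆Y =
  sat (∈-map⁺ dropNeg (∈-filter⁺ (λ r → ¬? (blocked? X r)) r∈P unblocked))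
      body⁺⊆Y (λ ())

answerSet-transfer : ∀ {P Q X} → AnswerSet P X → ReductModel X X Q →
  (∀ {Y} → Y ⊆ X → ReductModel Y X Q → ReductModel Y X P) → AnswerSet Q X
answerSet-transfer {P} {Q} (consistent , _ , minimal) modelQ lift =
  consistent , reductModel⇒satisfies Q modelQ ,
  λ Y Y⊂X consistentY satY →
    minimal Y Y⊂X consistentY
      (reductModel⇒satisfies P (lift (proj₁ Y⊂X) (satisfies⇒reductModel Q satY)))

-- Rules of P whose heads are false in X can be dropped: below X such a rule
-- can never fire, since X itself would then make its head true.
answerSet-dropFalseHeads : ∀ {P Q X} → AnswerSet P X → (∀ {r} → r ∈ Q → r ∈ P) →
  (∀ {r} → r ∈ P → r ∈ Q ⊎ ¬ HeadMeets X r) → AnswerSet Q X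
answerSet-dropFalseHeads {P} {Q} {X} asP Q⊆P P⊆Q∪falseHeads =
  answerSet-transfer asP (λ r∈Q → modelP (Q⊆P r∈Q)) lift
  where
  modelP : ReductModel X X P
  modelP = satisfies⇒reductModel P (proj₁ (proj₂ asP))

  lift : ∀ {Y} → Y ⊆ X → ReductModel Y X Q → ReductModel Y X P
  lift Y⊆X modelQ r∈P unblocked body⁺⊆Y with P⊆Q∪falseHeads r∈P
  ... | inj₁ r∈Q = modelQ r∈Q unblocked body⁺⊆Y
  ... | inj₂ headFalse =
    ⊥-elim (headFalse (modelP r∈P unblocked (λ l∈ → Y⊆X (body⁺⊆Y l∈))))

-- Rules of S whose heads are true in X can be replaced by their bodiless
-- versions f(r): X still models the facts, and a fact is stronger than the rule.
answerSet-factsOfTrueHeads : ∀ P {S X} → AnswerSet (P ++ S) X →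
  (∀ {r} → r ∈ S → HeadMeets X r) → AnswerSet (P ++ fs S) X
answerSet-factsOfTrueHeads P {S} {X} asPS headsTrue =
  answerSet-transfer asPS modelFacts lift
  where
  modelFacts : ReductModel X X (P ++ fs S)
  modelFacts r∈ unblocked body⁺⊆X with ∈-++⁻ P r∈
  ... | inj₁ r∈P =
    satisfies⇒reductModel (P ++ S) (proj₁ (proj₂ asPS)) (∈-++⁺ˡ r∈P) unblocked body⁺⊆X
  ... | inj₂ r∈fs with ∈-map⁻ f r∈fs
  ... | s , s∈S , refl = headsTrue s∈S

  lift : ∀ {Y} → Y ⊆ X → ReductModel Y X (P ++ fs S) → ReductModel Y X (P ++ S)
  lift _ modelY r∈ unblocked body⁺⊆Y with ∈-++⁻ P r∈
  ... | inj₁ r∈P = modelY (∈-++⁺ˡ r∈P) unblocked body⁺⊆Y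
  ... | inj₂ r∈S = modelY (∈-++⁺ʳ P (∈-map⁺ f r∈S)) (λ ()) (λ ())

_≟CR_ : DecidableEquality CRRule
crrule h b⁺ b⁻ ≟CR crrule h' b⁺' b⁻'
  with h ≟L h' | ≡-dec _≟L_ b⁺ b⁺' | ≡-dec _≟L_ b⁻ b⁻'
... | yes refl | yes refl | yes refl = yes refl
... | no h≢h'  | _        | _        = no λ { refl → h≢h' refl }
... | _        | no b⁺≢   | _        = no λ { refl → b⁺≢ refl }
... | _        | _        | no b⁻≢   = no λ { refl → b⁻≢ refl }

remove : CRRule → List CRRule → List CRRule
remove c = filter (λ d → ¬? (d ≟CR c))

answerSet-removeCR : ∀ Reg R {X c} → AnswerSet (Reg ++ αs R) X → crHead c ∉ X →
  AnswerSet (Reg ++ αs (remove c R)) X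
answerSet-removeCR Reg R {X} {c} asX c∉X =
  answerSet-dropFalseHeads asX shrink split
  where
  shrink : ∀ {r} → r ∈ Reg ++ αs (remove c R) → r ∈ Reg ++ αs R
  shrink r∈ with ∈-++⁻ Reg r∈
  ... | inj₁ r∈Reg = ∈-++⁺ˡ r∈Reg
  ... | inj₂ r∈α with ∈-map⁻ α r∈α
  ... | d , d∈ , refl =
    ∈-++⁺ʳ Reg (∈-map⁺ α (proj₁ (∈-filter⁻ (λ d → ¬? (d ≟CR c)) {xs = R} d∈)))

  split : ∀ {r} → r ∈ Reg ++ αs R → r ∈ Reg ++ αs (remove c R) ⊎ ¬ HeadMeets X r
  split r∈ with ∈-++⁻ Reg r∈
  ... | inj₁ r∈Reg = inj₁ (∈-++⁺ˡ r∈Reg)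
  ... | inj₂ r∈α with ∈-map⁻ α r∈α
  ... | d , d∈R , refl with d ≟CR c
  ... | yes refl = inj₂ λ { (_ , here refl , c∈X) → c∉X c∈X }
  ... | no d≢c   =
    inj₁ (∈-++⁺ʳ Reg (∈-map⁺ α (∈-filter⁺ (λ d → ¬? (d ≟CR c)) d∈R d≢c)))

-- Every cr-rule used in a corresponding abductive support has its head in X:
-- otherwise removing it gives a strictly smaller set of cr-rules under which
-- P^reg ∪ α(R) still has the answer set X, contradicting minimality of R.
supportHeadsTrue : ∀ P X R → AnswerSetWithSupport P X R →
  ∀ {c} → c ∈ R → crHead c ∈ X
supportHeadsTrue P X R (((unique , R⊆cr) , _ , minimal) , asX) {c} c∈R
  with mem? _≟L_ (crHead c) X
... | yes c∈X = c∈X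
... | no c∉X = ⊥-elim (minimal (remove c R) subset shorter
                        (X , answerSet-removeCR (reg P) R asX c∉X))
  where
  keep? : (d : CRRule) → Dec (¬ d ≡ c)
  keep? d = ¬? (d ≟CR c)

  subset : CRSubset P (remove c R)
  subset = Unique.filter⁺ keep? unique
         , λ d∈ → R⊆cr (proj₁ (∈-filter⁻ keep? {xs = R} d∈))

  shorter : length (remove c R) < length R
  shorter = filter-notAll keep? R (Any.map (λ { refl c≢c → c≢c refl }) c∈R)

lemma6 : (P : CRProgram) (X : LitSet) (R : List CRRule) →
    AnswerSetWithSupport P X R →
    AnswerSet (reg P ++ fs (αs R)) X
lemma6 P X R support = answerSet-factsOfTrueHeads (reg P) (proj₂ support) αHeadsTrue
  where
  αHeadsTrue : ∀ {r} → r ∈ αs R → HeadMeets X r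
  αHeadsTrue r∈ with ∈-map⁻ α r∈
  ... | c , c∈R , refl = crHead c , here refl , supportHeadsTrue P X R support c∈R
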